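{- Let $m,n \ge 2$. If there exists a perfect $1$-error-correcting code in the Cartesian product $C_m \square C_n \square C_2$, then there exists a quasi-perfect $1$-error-correcting code in $C_m \square C_n \square C_4$, and hence in $C_m \square C_n \square C_{4k}$ for every positive integer $k$.
   Context: All graphs are simple and connected; $d(x,y)$ is the shortest-path distance. For $n\ge 3$, $C_n$ is the cycle on $n$ vertices; by convention $C_2$ is a single edge (i.e. $K_2$) and $C_1$ is a single vertex. The Cartesian product $G\square H$ has vertex set $V(G)\times V(H)$, with $(g_1,h_1)$ adjacent to $(g_2,h_2)$ iff either $h_1=h_2$ and $g_1g_2\in E(G)$, or $g_1=g_2$ and $h_1h_2\in E(H)$. A code is a subset $D$ of the vertex set. $D$ is $t$-error-correcting if any two distinct codewords are at distance at least $2t+1$. The covering radius of $D$ is the smallest $r$ such that every vertex is at distance at most $r$ from some codeword. A perfect $t$-error-correcting code is a $t$-error-correcting code with covering radius $t$; a quasi-perfect $t$-error-correcting code is a $t$-error-correcting code with covering radius $t+1$. -}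

module Defs where

open import Data.Nat using (ℕ; zero; suc; _+_; _≤_; _<_)
open import Data.Fin using (Fin; toℕ)
open import Data.Bool using (Bool; true)
open import Data.Product using (Σ; ∃; _×_; _,_)
open import Data.Sum using (_⊎_)
open import Relation.Nullary using (¬_)
open import Relation.Binary.PropositionalEquality using (_≡_)

record Graph : Set₁ where
  field
    V   : Set
    Adj : V → V → Set
open Graph public

-- Cycle C_k on vertex set Fin k: i ~ j iff they are consecutive, or
-- (for k ≥ 3) they are 0 and k-1.  For k = 2 this is a single edge (K_2),
-- for k = 1 a single vertex with no edges.
CycAdj : (k : ℕ) → Fin k → Fin k → Set
CycAdj k i j =
  (suc (toℕ i) ≡ toℕ j) ⊎ (suc (toℕ j) ≡ toℕ i)
  ⊎ (3 ≤ k × ((toℕ i ≡ 0 × suc (toℕ j) ≡ k) ⊎ (toℕ j ≡ 0 × suc (toℕ i) ≡ k)))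

Cycle : ℕ → Graph
Cycle k = record { V = Fin k ; Adj = CycAdj k }

_□_ : Graph → Graph → Graph
G □ H = record
  { V   = V G × V H
  ; Adj = λ { (g₁ , h₁) (g₂ , h₂) →
              (h₁ ≡ h₂ × Adj G g₁ g₂) ⊎ (g₁ ≡ g₂ × Adj H h₁ h₂) } }
infixr 6 _□_

data Walk (G : Graph) : V G → V G → ℕ → Set where
  here : ∀ {x} → Walk G x x 0
  step : ∀ {x y z l} → Adj G x y → Walk G y z l → Walk G x z (suc l)

DistLe : (G : Graph) → V G → V G → ℕ → Set
DistLe G x y r = Σ ℕ λ l → l ≤ r × Walk G x y l

Code : Graph → Set
Code G = V G → Bool

-- t-error-correcting: distinct codewords are at distance ≥ 2t+1,
-- i.e. not at distance ≤ 2t.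
ErrorCorrecting : (G : Graph) → ℕ → Code G → Set
ErrorCorrecting G t D =
  ∀ x y → D x ≡ true → D y ≡ true → ¬ (x ≡ y) → ¬ DistLe G x y (t + t)

Covers : (G : Graph) → Code G → ℕ → Set
Covers G D r = ∀ v → Σ (V G) λ c → D c ≡ true × DistLe G c v r

CoveringRadius : (G : Graph) → Code G → ℕ → Set
CoveringRadius G D r = Covers G D r × (∀ r' → r' < r → ¬ Covers G D r')

Perfect : (G : Graph) → ℕ → Code G → Set
Perfect G t D = ErrorCorrecting G t D × CoveringRadius G D t

QuasiPerfect : (G : Graph) → ℕ → Code G → Set
QuasiPerfect G t D = ErrorCorrecting G t D × CoveringRadius G D (suc t)

-- Spread the perfect code D of G □ C₂ over G □ C_K (4 ∣ K): the layers of C_K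
-- whose index is 0 resp. 2 mod 4 carry copies of the layers 0 resp. 1 of D, the
-- odd layers stay empty.  Folding C_K onto C₂ by i ↦ ⌊(i mod 4)/2⌋ does not
-- increase distances, so two codewords at distance ≤ 2 fold onto the same
-- codeword of D; they then lie in layers of equal residue mod 4 at distance ≤ 2,
-- which forces them to coincide.  Every layer is within distance 1 of a layer
-- carrying a copy of its own fold and within distance 2 of one carrying the other,
-- so the perfect covering of D by radius-1 balls gives covering radius 2.  A vertex
-- of an odd layer lying over a neighbour of a codeword of D sees no codeword
-- within distance 1, so the covering radius is exactly 2.
module Submission where

open import Defs
open import Data.Nat using (ℕ; zero; suc; _≤_; _<_; _*_; z≤n; s≤s; _<?_)
open import Data.Nat.Properties
  using (≤-refl; ≤-trans; ≤-pred; n≤1+n; <-irrefl; ≮⇒≥; ≤-antisym; suc-injective; 1+n≢0; *-monoʳ-≤)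
open import Data.Nat.Divisibility using (_∣_; divides; m∣m*n)
open import Data.Fin using (Fin; toℕ; fromℕ; fromℕ<; inject₁; opposite) renaming (zero to fzero; suc to fsuc)
open import Data.Fin.Patterns using (0F; 1F; 2F; 3F)
open import Data.Fin.Properties using (toℕ-fromℕ; toℕ-fromℕ<; toℕ-inject₁; toℕ-injective; toℕ<n)
open import Data.Bool using (Bool; true; false; _∧_)
open import Data.Product using (Σ; _×_; _,_; proj₁; proj₂; map₂)
open import Data.Sum using (_⊎_; inj₁; inj₂) renaming (map to ⊎-map)
open import Data.Empty using (⊥-elim)
open import Function using (_∘_)
open import Relation.Nullary using (¬_; yes; no)
open import Relation.Binary.PropositionalEquality

private
  variable
    G H L : Graph
    r r' t : ℕ

record Nonexpanding (G H : Graph) (f : V G → V H) : Set where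
  constructor nonexpanding
  field adjacent : ∀ {x y} → Adj G x y → f x ≡ f y ⊎ Adj H (f x) (f y)

DistLe-map : ∀ {f} → Nonexpanding G H f → ∀ {x y} → DistLe G x y r → DistLe H (f x) (f y) r
DistLe-map {G = G} {H = H} {f = f} (nonexpanding f-adjacent) (l , l≤r , w) = walk-map w l≤r
  where
  walk-map : ∀ {x y l r} → Walk G x y l → l ≤ r → DistLe H (f x) (f y) r
  walk-map here _ = 0 , z≤n , here
  walk-map {y = y} (step a w) (s≤s l≤r) with walk-map w l≤r | f-adjacent a
  ... | l' , l'≤r , w' | inj₁ same =
    l' , ≤-trans l'≤r (n≤1+n _) , subst (λ u → Walk H u (f y) l') (sym same) w'
  ... | l' , l'≤r , w' | inj₂ a'   = suc l' , s≤s l'≤r , step a' w'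

DistLe-step : ∀ {x y z} → Adj G x y → DistLe G y z r → DistLe G x z (suc r)
DistLe-step a (l , l≤r , w) = suc l , s≤s l≤r , step a w

DistLe-refl : ∀ {x} → DistLe G x x r
DistLe-refl = 0 , z≤n , here

DistLe-adj : ∀ {x y} → Adj G x y → DistLe G x y 1
DistLe-adj a = DistLe-step a DistLe-refl

DistLe-weaken : ∀ {x y} → r ≤ r' → DistLe G x y r → DistLe G x y r'
DistLe-weaken r≤r' (l , l≤r , w) = l , ≤-trans l≤r r≤r' , w

Covers-weaken : ∀ {D} → r ≤ r' → Covers G D r → Covers G D r'
Covers-weaken r≤r' cov v with cov v
... | c , Dc , d = c , Dc , DistLe-weaken r≤r' d

Covers-cong : ∀ {D D'} → (∀ x → D x ≡ D' x) → Covers G D r → Covers G D' r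
Covers-cong D≗D' cov v with cov v
... | c , Dc , d = c , trans (sym (D≗D' c)) Dc , d

□-mapʳ-nonexpanding : ∀ {f} → Nonexpanding H L f → Nonexpanding (G □ H) (G □ L) (map₂ f)
□-mapʳ-nonexpanding (nonexpanding f-adjacent) = nonexpanding λ
  { (inj₁ (refl , a)) → inj₂ (inj₁ (refl , a))
  ; (inj₂ (refl , a)) → ⊎-map (cong (_ ,_)) (λ a' → inj₂ (refl , a')) (f-adjacent a) }

□-proj₂-nonexpanding : Nonexpanding (G □ H) H proj₂
□-proj₂-nonexpanding = nonexpanding λ
  { (inj₁ (refl , _)) → inj₁ refl
  ; (inj₂ (_ , a))    → inj₂ a }

□-DistLeʳ : ∀ {g x y} → DistLe H x y r → DistLe (G □ H) (g , x) (g , y) r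
□-DistLeʳ = DistLe-map (nonexpanding λ a → inj₂ (inj₂ (refl , a)))

□-irreflexive : (∀ {g} → ¬ Adj G g g) → (∀ {h} → ¬ Adj H h h) → ∀ {v} → ¬ Adj (G □ H) v v
□-irreflexive G-irrefl H-irrefl (inj₁ (_ , a)) = G-irrefl a
□-irreflexive G-irrefl H-irrefl (inj₂ (_ , a)) = H-irrefl a

□-neighbourˡ : (∀ g → Σ (V G) (Adj G g)) → ∀ v → Σ (V (G □ H)) (Adj (G □ H) v)
□-neighbourˡ G-neighbour (g , h) = (proj₁ (G-neighbour g) , h) , inj₁ (refl , proj₂ (G-neighbour g))

infix 4 _≅_

record _≅_ (G H : Graph) : Set where
  field
    to       : V G → V H
    from     : V H → V G
    from∘to  : ∀ x → from (to x) ≡ x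
    to∘from  : ∀ y → to (from y) ≡ y
    to-adj   : ∀ {x y} → Adj G x y → Adj H (to x) (to y)
    from-adj : ∀ {x y} → Adj H x y → Adj G (from x) (from y)

  from-injective : ∀ {x y} → from x ≡ from y → x ≡ y
  from-injective {x} {y} e = trans (sym (to∘from x)) (trans (cong to e) (to∘from y))

≅-sym : G ≅ H → H ≅ G
≅-sym i = record { to = from ; from = to ; from∘to = to∘from ; to∘from = from∘to
                 ; to-adj = from-adj ; from-adj = to-adj }
  where open _≅_ i

□-assoc : (G □ H) □ L ≅ G □ (H □ L)
□-assoc = record
  { to       = λ { ((g , h) , l) → g , (h , l) }
  ; from     = λ { (g , (h , l)) → (g , h) , l }
  ; from∘to  = λ _ → refl
  ; to∘from  = λ _ → refl
  ; to-adj   = λ { (inj₁ (refl , inj₁ (refl , a))) → inj₁ (refl , a)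
                 ; (inj₁ (refl , inj₂ (refl , a))) → inj₂ (refl , inj₁ (refl , a))
                 ; (inj₂ (refl , a))               → inj₂ (refl , inj₂ (refl , a)) }
  ; from-adj = λ { (inj₁ (refl , a))               → inj₁ (refl , inj₁ (refl , a))
                 ; (inj₂ (refl , inj₁ (refl , a))) → inj₁ (refl , inj₂ (refl , a))
                 ; (inj₂ (refl , inj₂ (refl , a))) → inj₂ (refl , a) }
  }

module _ (i : G ≅ H) where
  open _≅_ i

  ErrorCorrecting-transfer : ∀ {t D} → ErrorCorrecting G t D → ErrorCorrecting H t (D ∘ from)
  ErrorCorrecting-transfer ec x y Dx Dy x≢y d =
    ec (from x) (from y) Dx Dy (x≢y ∘ from-injective) (DistLe-map (nonexpanding (inj₂ ∘ from-adj)) d)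

  Covers-transfer : ∀ {D} → Covers G D r → Covers H (D ∘ from) r
  Covers-transfer {r = r} {D = D} cov v with cov (from v)
  ... | c , Dc , d =
    to c , trans (cong D (from∘to c)) Dc ,
    subst (λ y → DistLe H (to c) y r) (to∘from v) (DistLe-map (nonexpanding (inj₂ ∘ to-adj)) d)

QuasiPerfect-transfer : ∀ {D} (i : G ≅ H) → QuasiPerfect G t D → QuasiPerfect H t (D ∘ _≅_.from i)
QuasiPerfect-transfer {t = t} {D = D} i (ec , cov , minimal) =
  ErrorCorrecting-transfer i {t = t} ec ,
  Covers-transfer i cov ,
  λ r' r'<r cov' → minimal r' r'<r
    (Covers-cong (λ x → cong D (_≅_.from∘to i x)) (Covers-transfer (≅-sym i) cov'))

no-wrap-loop : ∀ {k i} → i ≡ 0 → suc i ≡ k → ¬ 3 ≤ k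
no-wrap-loop refl refl (s≤s ())

CycAdj-irrefl : ∀ {k} {i : Fin k} → ¬ CycAdj k i i
CycAdj-irrefl (inj₁ e)                          = <-irrefl (sym e) ≤-refl
CycAdj-irrefl (inj₂ (inj₁ e))                   = <-irrefl (sym e) ≤-refl
CycAdj-irrefl (inj₂ (inj₂ (3≤k , inj₁ (i≡0 , e)))) = no-wrap-loop i≡0 e 3≤k
CycAdj-irrefl (inj₂ (inj₂ (3≤k , inj₂ (i≡0 , e)))) = no-wrap-loop i≡0 e 3≤k

CycAdj-sym : ∀ {k} {i j : Fin k} → CycAdj k i j → CycAdj k j i
CycAdj-sym (inj₁ e)                  = inj₂ (inj₁ e)
CycAdj-sym (inj₂ (inj₁ e))           = inj₁ e
CycAdj-sym (inj₂ (inj₂ (h , inj₁ e))) = inj₂ (inj₂ (h , inj₂ e))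
CycAdj-sym (inj₂ (inj₂ (h , inj₂ e))) = inj₂ (inj₂ (h , inj₁ e))

cycle-neighbour : ∀ {k} → 2 ≤ k → (i : Fin k) → Σ (Fin k) (CycAdj k i)
cycle-neighbour {k} 2≤k i with toℕ i in eq
... | zero  = fromℕ< 2≤k , inj₁ (sym (toℕ-fromℕ< 2≤k))
... | suc j = fromℕ< j<k , inj₂ (inj₁ (cong suc (toℕ-fromℕ< j<k)))
  where
  j<k : j < k
  j<k = ≤-trans (n≤1+n (suc j)) (subst (_< k) eq (toℕ<n i))

Cycle₂-complete : (s t : Fin 2) → s ≡ t ⊎ CycAdj 2 s t
Cycle₂-complete 0F 0F = inj₁ refl
Cycle₂-complete 0F 1F = inj₂ (inj₁ refl)
Cycle₂-complete 1F 0F = inj₂ (inj₂ (inj₁ refl))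
Cycle₂-complete 1F 1F = inj₁ refl

Cycle₂-DistLe₁ : (s t : Fin 2) → DistLe (Cycle 2) s t 1
Cycle₂-DistLe₁ s t with Cycle₂-complete s t
... | inj₁ refl = DistLe-refl
... | inj₂ a    = DistLe-adj a

Cycle₂-adjacent⇒opposite : ∀ {s t : Fin 2} → CycAdj 2 s t → s ≡ opposite t
Cycle₂-adjacent⇒opposite {0F} {1F} _ = refl
Cycle₂-adjacent⇒opposite {1F} {0F} _ = refl
Cycle₂-adjacent⇒opposite {0F} {0F} a = ⊥-elim (CycAdj-irrefl a)
Cycle₂-adjacent⇒opposite {1F} {1F} a = ⊥-elim (CycAdj-irrefl a)

CycSucc : (k : ℕ) → Fin k → Fin k → Set
CycSucc k i j = suc (toℕ i) ≡ toℕ j ⊎ (suc (toℕ i) ≡ k × toℕ j ≡ 0)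

CycAdj⇒CycSucc : ∀ {k} {i j : Fin k} → CycAdj k i j → CycSucc k i j ⊎ CycSucc k j i
CycAdj⇒CycSucc (inj₁ e)                            = inj₁ (inj₁ e)
CycAdj⇒CycSucc (inj₂ (inj₁ e))                     = inj₂ (inj₁ e)
CycAdj⇒CycSucc (inj₂ (inj₂ (_ , inj₁ (i≡0 , j+1≡k)))) = inj₂ (inj₂ (j+1≡k , i≡0))
CycAdj⇒CycSucc (inj₂ (inj₂ (_ , inj₂ (j≡0 , i+1≡k)))) = inj₁ (inj₂ (i+1≡k , j≡0))

CycSucc⇒CycAdj : ∀ {k} {i j : Fin k} → 3 ≤ k → CycSucc k i j → CycAdj k i j
CycSucc⇒CycAdj _   (inj₁ e)              = inj₁ e
CycSucc⇒CycAdj 3≤k (inj₂ (i+1≡k , j≡0)) = inj₂ (inj₂ (3≤k , inj₂ (j≡0 , i+1≡k)))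

CycSucc-functional : ∀ {k} {i j j' : Fin k} → CycSucc k i j → CycSucc k i j' → j ≡ j'
CycSucc-functional (inj₁ e)       (inj₁ e')        = toℕ-injective (trans (sym e) e')
CycSucc-functional {j = j} (inj₁ e) (inj₂ (e' , _)) = ⊥-elim (<-irrefl (trans (sym e) e') (toℕ<n j))
CycSucc-functional {j' = j'} (inj₂ (e , _)) (inj₁ e') = ⊥-elim (<-irrefl (trans (sym e') e) (toℕ<n j'))
CycSucc-functional (inj₂ (_ , j≡0)) (inj₂ (_ , j'≡0)) = toℕ-injective (trans j≡0 (sym j'≡0))

CycSucc-injective : ∀ {k} {i i' j : Fin k} → CycSucc k i j → CycSucc k i' j → i ≡ i'
CycSucc-injective (inj₁ e)       (inj₁ e')        = toℕ-injective (suc-injective (trans e (sym e')))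
CycSucc-injective (inj₁ e)       (inj₂ (_ , j≡0)) = ⊥-elim (1+n≢0 (trans e j≡0))
CycSucc-injective (inj₂ (_ , j≡0)) (inj₁ e')      = ⊥-elim (1+n≢0 (trans e' j≡0))
CycSucc-injective (inj₂ (e , _)) (inj₂ (e' , _))  = toℕ-injective (suc-injective (trans e (sym e')))

cycSucc : ∀ {k} (i : Fin k) → Σ (Fin k) (CycSucc k i)
cycSucc {suc k} i with suc (toℕ i) <? suc k
... | yes i+1<k = fromℕ< i+1<k , inj₁ (sym (toℕ-fromℕ< i+1<k))
... | no  i+1≮k = fzero , inj₂ (≤-antisym (toℕ<n i) (≮⇒≥ i+1≮k) , refl)

cycPred : ∀ {k} (j : Fin k) → Σ (Fin k) λ i → CycSucc k i j
cycPred {suc k} fzero    = fromℕ k , inj₂ (cong suc (toℕ-fromℕ k) , refl)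
cycPred {suc k} (fsuc j) = inject₁ j , inj₁ (cong suc (toℕ-inject₁ j))

rot : Fin 4 → Fin 4
rot 0F = 1F
rot 1F = 2F
rot 2F = 3F
rot 3F = 0F

rot⁴ : ∀ x → rot (rot (rot (rot x))) ≡ x
rot⁴ 0F = refl
rot⁴ 1F = refl
rot⁴ 2F = refl
rot⁴ 3F = refl

rot-injective : ∀ {x y} → rot x ≡ rot y → x ≡ y
rot-injective {x} {y} e = begin
  x                        ≡⟨ sym (rot⁴ x) ⟩
  rot (rot (rot (rot x)))  ≡⟨ cong (rot ∘ rot ∘ rot) e ⟩
  rot (rot (rot (rot y)))  ≡⟨ rot⁴ y ⟩
  y                        ∎
  where open ≡-Reasoning

rot-fixpoint-free : ∀ x → rot x ≢ x
rot-fixpoint-free 0F ()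
rot-fixpoint-free 1F ()
rot-fixpoint-free 2F ()
rot-fixpoint-free 3F ()

rot²-fixpoint-free : ∀ x → rot (rot x) ≢ x
rot²-fixpoint-free 0F ()
rot²-fixpoint-free 1F ()
rot²-fixpoint-free 2F ()
rot²-fixpoint-free 3F ()

mod4 : ℕ → Fin 4
mod4 zero    = 0F
mod4 (suc n) = rot (mod4 n)

mod4-multiple : ∀ {k} → 4 ∣ k → mod4 k ≡ 0F
mod4-multiple (divides q refl) = mod4-*4 q
  where
  mod4-*4 : ∀ q → mod4 (q * 4) ≡ 0F
  mod4-*4 zero    = refl
  mod4-*4 (suc q) = trans (rot⁴ (mod4 (q * 4))) (mod4-*4 q)

module CyclePhases {K : ℕ} (3≤K : 3 ≤ K) (K≡0 : mod4 K ≡ 0F) where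

  phase : Fin K → Fin 4
  phase i = mod4 (toℕ i)

  phase-succ : ∀ {i j} → CycSucc K i j → phase j ≡ rot (phase i)
  phase-succ (inj₁ e)              = cong mod4 (sym e)
  phase-succ {i} {j} (inj₂ (i+1≡K , j≡0)) = begin
    mod4 (toℕ j)       ≡⟨ cong mod4 j≡0 ⟩
    0F                 ≡⟨ sym K≡0 ⟩
    mod4 K             ≡⟨ cong mod4 (sym i+1≡K) ⟩
    mod4 (suc (toℕ i)) ∎
    where open ≡-Reasoning

  phase-succ² : ∀ {i j l} → CycSucc K i j → CycSucc K j l → phase l ≡ rot (rot (phase i))
  phase-succ² s s' = trans (phase-succ s') (cong rot (phase-succ s))

  -- Equal phases at distance ≤ 2 either force two steps in one direction
  -- (rot² has no fixpoint) or a step forth and back.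
  phase-separated : ∀ {i j} → phase i ≡ phase j → DistLe (Cycle K) i j 2 → i ≡ j
  phase-separated e (0 , _ , here) = refl
  phase-separated e (1 , _ , step a here) with CycAdj⇒CycSucc a
  ... | inj₁ s = ⊥-elim (rot-fixpoint-free _ (trans (sym (phase-succ s)) (sym e)))
  ... | inj₂ s = ⊥-elim (rot-fixpoint-free _ (trans (sym (phase-succ s)) e))
  phase-separated e (2 , _ , step a (step b here)) with CycAdj⇒CycSucc a | CycAdj⇒CycSucc b
  ... | inj₁ s | inj₁ s' = ⊥-elim (rot²-fixpoint-free _ (trans (sym (phase-succ² s s')) (sym e)))
  ... | inj₁ s | inj₂ s' = CycSucc-injective s s'
  ... | inj₂ s | inj₁ s' = CycSucc-functional s s'
  ... | inj₂ s | inj₂ s' = ⊥-elim (rot²-fixpoint-free _ (trans (sym (phase-succ² s' s)) e))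
  phase-separated e (suc (suc (suc _)) , s≤s (s≤s ()) , _)

  step-back : ∀ c → Σ (Fin K) λ p → rot (phase p) ≡ phase c × CycAdj K p c
  step-back c with cycPred c
  ... | p , s = p , sym (phase-succ s) , CycSucc⇒CycAdj 3≤K s

  step-forward : ∀ c → Σ (Fin K) λ d → phase d ≡ rot (phase c) × CycAdj K d c
  step-forward c with cycSucc c
  ... | d , s = d , phase-succ s , CycAdj-sym (CycSucc⇒CycAdj 3≤K s)

  two-steps-forward : ∀ c → Σ (Fin K) λ d → phase d ≡ rot (rot (phase c)) × DistLe (Cycle K) d c 2
  two-steps-forward c with step-forward c
  ... | d , d-phase , a with step-forward d
  ...   | d' , d'-phase , a' = d' , trans d'-phase (cong rot d-phase) , DistLe-step a' (DistLe-adj a)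

  phase-one : Σ (Fin K) λ c → phase c ≡ 1F
  phase-one = fromℕ< 1<K , cong mod4 (toℕ-fromℕ< 1<K)
    where
    1<K : 1 < K
    1<K = ≤-trans (n≤1+n 2) 3≤K

fold : Fin 4 → Fin 2
fold 0F = 0F
fold 1F = 0F
fold 2F = 1F
fold 3F = 1F

even : Fin 4 → Bool
even 0F = true
even 1F = false
even 2F = true
even 3F = false

layer : Fin 2 → Fin 4
layer 0F = 0F
layer 1F = 2F

module Lift (G : Graph) (G-irrefl : ∀ {g} → ¬ Adj G g g) (neighbour : ∀ g → Σ (V G) (Adj G g))
  (g₀ : V G) {K : ℕ} (4≤K : 4 ≤ K) (4∣K : 4 ∣ K)
  (D : Code (G □ Cycle 2)) (ec : ErrorCorrecting (G □ Cycle 2) 1 D) (cov : Covers (G □ Cycle 2) D 1)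
  where

  open CyclePhases (≤-trans (n≤1+n 3) 4≤K) (mod4-multiple 4∣K)

  layerCode : V G → Fin 4 → Bool
  layerCode g x = even x ∧ D (g , fold x)

  liftCode : Code (G □ Cycle K)
  liftCode (g , c) = layerCode g (phase c)

  layerCode-layer : ∀ g s → layerCode g (layer s) ≡ D (g , s)
  layerCode-layer g 0F = refl
  layerCode-layer g 1F = refl

  layerCode-true : ∀ {g} x → layerCode g x ≡ true → x ≡ layer (fold x) × D (g , fold x) ≡ true
  layerCode-true 0F h = refl , h
  layerCode-true 1F ()
  layerCode-true 2F h = refl , h
  layerCode-true 3F ()

  liftCode-on-layer : ∀ {g} c {s} → phase c ≡ layer s → liftCode (g , c) ≡ D (g , s)
  liftCode-on-layer {g} _ {s} e = trans (cong (layerCode g) e) (layerCode-layer g s)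

  home-layer : ∀ c → Σ (Fin K) λ h → phase h ≡ layer (fold (phase c)) × DistLe (Cycle K) h c 1
  home-layer c with phase c in eq | step-back c
  ... | 0F | _ = c , eq , DistLe-refl
  ... | 1F | p , p-phase , a = p , rot-injective p-phase , DistLe-adj a
  ... | 2F | _ = c , eq , DistLe-refl
  ... | 3F | p , p-phase , a = p , rot-injective p-phase , DistLe-adj a

  opposite-layer : ∀ c → Σ (Fin K) λ o → phase o ≡ layer (opposite (fold (phase c))) × DistLe (Cycle K) o c 2
  opposite-layer c with phase c | step-forward c | two-steps-forward c
  ... | 0F | _ | o , o-phase , d = o , o-phase , d
  ... | 1F | o , o-phase , a | _ = o , o-phase , DistLe-weaken (n≤1+n 1) (DistLe-adj a)
  ... | 2F | _ | o , o-phase , d = o , o-phase , d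
  ... | 3F | o , o-phase , a | _ = o , o-phase , DistLe-weaken (n≤1+n 1) (DistLe-adj a)

  liftCode-errorCorrecting : ErrorCorrecting (G □ Cycle K) 1 liftCode
  liftCode-errorCorrecting (g , c) (g' , c') c-code c'-code x≢y d =
    ec _ _ (proj₂ c-layer) (proj₂ c'-layer) folds-differ
       (DistLe-map (□-mapʳ-nonexpanding {G = G} fold-nonexpanding) d)
    where
    c-layer  = layerCode-true (phase c) c-code
    c'-layer = layerCode-true (phase c') c'-code

    fold-nonexpanding : Nonexpanding (Cycle K) (Cycle 2) (fold ∘ phase)
    fold-nonexpanding = nonexpanding λ _ → Cycle₂-complete _ _

    folds-differ : (g , fold (phase c)) ≢ (g' , fold (phase c'))
    folds-differ e = x≢y (cong₂ _,_ (cong proj₁ e)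
      (phase-separated (trans (proj₁ c-layer) (trans (cong (layer ∘ proj₂) e) (sym (proj₁ c'-layer))))
                       (DistLe-map (□-proj₂-nonexpanding {G = G}) d)))

  liftCode-covers : Covers (G □ Cycle K) liftCode 2
  liftCode-covers (g , c) with cov (g , fold (phase c)) | home-layer c
  ... | _ , Du , (0 , _ , here) | h , h-layer , h-near =
    (g , h) , trans (liftCode-on-layer h h-layer) Du , DistLe-weaken (n≤1+n 1) (□-DistLeʳ {G = G} h-near)
  ... | (g' , _) , Du , (1 , _ , step (inj₁ (refl , a)) here) | h , h-layer , h-near =
    (g' , h) , trans (liftCode-on-layer h h-layer) Du , DistLe-step (inj₁ (refl , a)) (□-DistLeʳ {G = G} h-near)
  ... | _ , Du , (1 , _ , step (inj₂ (refl , a)) here) | _ with opposite-layer c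
  ...   | o , o-layer , o-near =
    (g , o) , trans (liftCode-on-layer o (trans o-layer (cong layer (sym (Cycle₂-adjacent⇒opposite a))))) Du ,
    □-DistLeʳ {G = G} o-near
  liftCode-covers _ | _ , _ , (suc (suc _) , s≤s () , _) | _

  -- The whole fibre over a neighbour g' of a codeword (g , s) of D lies within
  -- distance 2 of (g , s), so no layer over g' carries a codeword.
  liftCode-not-covers₁ : ¬ Covers (G □ Cycle K) liftCode 1
  liftCode-not-covers₁ cov₁ with cov (g₀ , 0F)
  ... | (g , s) , Dgs , _ = no-codeword-near (cov₁ (g' , c₁))
    where
    g' = proj₁ (neighbour g)
    c₁ = proj₁ phase-one

    fibre-empty : ∀ t → D (g' , t) ≢ true
    fibre-empty t Dg't = ec (g , s) (g' , t) Dgs Dg't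
      (λ e → G-irrefl (subst (Adj G g) (sym (cong proj₁ e)) (proj₂ (neighbour g))))
      (DistLe-step (inj₁ (refl , proj₂ (neighbour g))) (□-DistLeʳ {G = G} (Cycle₂-DistLe₁ s t)))

    odd-layer-empty : ∀ {x} → liftCode (x , c₁) ≢ true
    odd-layer-empty e with () ← trans (sym (cong (layerCode _) (proj₂ phase-one))) e

    no-codeword-near : ¬ Σ (V (G □ Cycle K)) λ u → liftCode u ≡ true × DistLe (G □ Cycle K) u (g' , c₁) 1
    no-codeword-near (_ , u-code , (0 , _ , here))                       = odd-layer-empty u-code
    no-codeword-near (_ , u-code , (1 , _ , step (inj₁ (refl , _)) here)) = odd-layer-empty u-code
    no-codeword-near ((_ , c) , u-code , (1 , _ , step (inj₂ (refl , _)) here)) =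
      fibre-empty _ (proj₂ (layerCode-true (phase c) u-code))
    no-codeword-near (_ , _ , (suc (suc _) , s≤s () , _))

  liftCode-quasiPerfect : QuasiPerfect (G □ Cycle K) 1 liftCode
  liftCode-quasiPerfect =
    liftCode-errorCorrecting , liftCode-covers ,
    λ r r<2 cov-r → liftCode-not-covers₁ (Covers-weaken (≤-pred r<2) cov-r)

-- C_m □ C_n □ C_k parses as C_m □ (C_n □ C_k), so the construction, made for
-- (C_m □ C_n) □ C_k, is transported along associativity in both directions.
theorem6 : (m n : ℕ) → 2 ≤ m → 2 ≤ n →
    Σ (Code (Cycle m □ Cycle n □ Cycle 2)) (Perfect (Cycle m □ Cycle n □ Cycle 2) 1) →
    Σ (Code (Cycle m □ Cycle n □ Cycle 4)) (QuasiPerfect (Cycle m □ Cycle n □ Cycle 4) 1)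
    × ((k : ℕ) → 1 ≤ k →
       Σ (Code (Cycle m □ Cycle n □ Cycle (4 * k)))
         (QuasiPerfect (Cycle m □ Cycle n □ Cycle (4 * k)) 1))
theorem6 m n 2≤m 2≤n (D , ec , cov , _) = quasiPerfect 1 ≤-refl , quasiPerfect
  where
  Cmn = Cycle m □ Cycle n

  assoc : ∀ {K} → Cmn □ Cycle K ≅ Cycle m □ Cycle n □ Cycle K
  assoc = □-assoc

  quasiPerfect : (k : ℕ) → 1 ≤ k →
    Σ (Code (Cycle m □ Cycle n □ Cycle (4 * k))) (QuasiPerfect (Cycle m □ Cycle n □ Cycle (4 * k)) 1)
  quasiPerfect k 1≤k = liftCode ∘ _≅_.from assoc , QuasiPerfect-transfer assoc liftCode-quasiPerfect
    where
    open Lift Cmn (□-irreflexive {G = Cycle m} {H = Cycle n} CycAdj-irrefl CycAdj-irrefl)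
      (□-neighbourˡ {H = Cycle n} (cycle-neighbour 2≤m))
      (fromℕ< 2≤m , fromℕ< 2≤n) (*-monoʳ-≤ 4 1≤k) (m∣m*n k)
      (D ∘ _≅_.to assoc)
      (ErrorCorrecting-transfer (≅-sym assoc) {t = 1} ec)
      (Covers-transfer (≅-sym assoc) cov)
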